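{- Let $f,\ell,e,p$ be nonnegative integers with $e<f-\ell$ and $p+e\le\ell$. Then $$(f-e)\sum_{t=0}^e(-1)^t\binom{e}{t}\frac{1}{(f-\ell+p+t)!}-\sum_{t=0}^e(-1)^t\binom{e}{t}\frac{1}{(f-\ell-1+p+t)!}\ \ge\ 0.$$ -}

module Defs where

open import Data.Nat as ℕ using (ℕ; zero; suc; _!; _∸_)
open import Data.Nat.Properties using (_!≢0)
open import Data.Nat.Combinatorics using (_C_)
open import Data.Integer as ℤ using (ℤ; +_)
open import Data.Rational using (ℚ; _/_; _+_; _*_; -_; 0ℚ)
open import Data.List using (List; map; upTo)
import Data.List as List

-- Σ_{t=0}^{n} g t  (inclusive upper bound)
sumTo : ℕ → (ℕ → ℚ) → ℚ
sumTo n g = List.foldr _+_ 0ℚ (map g (upTo (suc n)))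

sgn : ℕ → ℚ
sgn zero = + 1 / 1
sgn (suc t) = - sgn t

inv! : ℕ → ℚ
inv! n = (+ 1 / (n !)) {{n !≢0}}

ℕ→ℚ : ℕ → ℚ
ℕ→ℚ n = + n / 1

-- Write D e m for the e-th alternating binomial sum of m ↦ 1/m!, so that
-- D (e + 1) m = D e m − D e (m + 1).  The weighted gap (n + 1)·D e (n + 1) − D e n
-- vanishes for e = 0 and equals e·D (e − 1) (n + 2) otherwise.  Using this, an
-- induction on e shows at once that D e m ≥ 0 for e ≤ m and D e (m + 1) ≤ D (e + 1) m
-- for e < m.  With n = f − ℓ − 1 + p the quantity of the theorem splits as
-- (f − e − n − 1)·D e (n + 1) plus the weighted gap at n, both nonnegative.
module Submission where

open import Data.Nat as ℕ using (ℕ; zero; suc; _!; _∸_; _≤_; _<_; z≤n; s≤s)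
open import Data.Nat.Properties using (_!≢0)
import Data.Nat.Properties as ℕP
open import Data.Nat.Combinatorics using (_C_; k>n⇒nCk≡0; nCk+nC[k+1]≡[n+1]C[k+1])
import Data.Integer as ℤ
import Data.Integer.Properties as ℤP
open import Data.Rational using (ℚ; 0ℚ; 1ℚ; _+_; _*_; _-_; -_; _/_; toℚᵘ; nonNegative)
import Data.Rational as ℚ
import Data.Rational.Properties as ℚP
open import Data.Rational.Solver using (module +-*-Solver)
open import Data.Rational.Unnormalised as ℚᵘ using (mkℚᵘ; *≡*) renaming (_/_ to _/ᵘ_)
import Data.Rational.Unnormalised.Properties as ℚᵘP
open import Data.List using (foldr; map; upTo)
open import Data.List.Properties using (map-applyUpTo; map-cong)
open import Function using (_∘_; id)
open import Relation.Binary.PropositionalEquality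

open import Defs

toℚᵘ-/ : ∀ a d .{{_ : ℕ.NonZero d}} → toℚᵘ (ℤ.+ a / d) ℚᵘ.≃ (ℤ.+ a /ᵘ d)
toℚᵘ-/ a (suc d) = ℚP.toℚᵘ-fromℚᵘ (mkℚᵘ (ℤ.+ a) d)

ℕ→ℚ-+ : ∀ m n → ℕ→ℚ (m ℕ.+ n) ≡ ℕ→ℚ m + ℕ→ℚ n
ℕ→ℚ-+ m n = ℚP.toℚᵘ-injective (begin
  toℚᵘ (ℕ→ℚ (m ℕ.+ n))           ≈⟨ toℚᵘ-/ (m ℕ.+ n) 1 ⟩
  ℤ.+ (m ℕ.+ n) /ᵘ 1              ≈⟨ *≡* (cong (ℤ._* ℤ.+ 1) numerator≡) ⟩
  (ℤ.+ m /ᵘ 1) ℚᵘ.+ (ℤ.+ n /ᵘ 1)  ≈⟨ ℚᵘP.+-cong (toℚᵘ-/ m 1) (toℚᵘ-/ n 1) ⟨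
  toℚᵘ (ℕ→ℚ m) ℚᵘ.+ toℚᵘ (ℕ→ℚ n) ≈⟨ ℚP.toℚᵘ-homo-+ (ℕ→ℚ m) (ℕ→ℚ n) ⟨
  toℚᵘ (ℕ→ℚ m + ℕ→ℚ n)           ∎)
  where
  open ℚᵘP.≃-Reasoning
  numerator≡ : ℤ.+ (m ℕ.+ n) ≡ ℤ.+ m ℤ.* ℤ.+ 1 ℤ.+ ℤ.+ n ℤ.* ℤ.+ 1
  numerator≡ = trans (ℤP.pos-+ m n) (sym (cong₂ ℤ._+_ (ℤP.*-identityʳ (ℤ.+ m)) (ℤP.*-identityʳ (ℤ.+ n))))

ℕ→ℚ-* : ∀ m n → ℕ→ℚ (m ℕ.* n) ≡ ℕ→ℚ m * ℕ→ℚ n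
ℕ→ℚ-* m n = ℚP.toℚᵘ-injective (begin
  toℚᵘ (ℕ→ℚ (m ℕ.* n))           ≈⟨ toℚᵘ-/ (m ℕ.* n) 1 ⟩
  ℤ.+ (m ℕ.* n) /ᵘ 1              ≈⟨ *≡* (cong (ℤ._* ℤ.+ 1) (ℤP.pos-* m n)) ⟩
  (ℤ.+ m /ᵘ 1) ℚᵘ.* (ℤ.+ n /ᵘ 1)  ≈⟨ ℚᵘP.*-cong (toℚᵘ-/ m 1) (toℚᵘ-/ n 1) ⟨
  toℚᵘ (ℕ→ℚ m) ℚᵘ.* toℚᵘ (ℕ→ℚ n) ≈⟨ ℚP.toℚᵘ-homo-* (ℕ→ℚ m) (ℕ→ℚ n) ⟨
  toℚᵘ (ℕ→ℚ m * ℕ→ℚ n)           ∎)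
  where open ℚᵘP.≃-Reasoning

inv!*ℕ→ℚ! : ∀ n → inv! n * ℕ→ℚ (n !) ≡ 1ℚ
inv!*ℕ→ℚ! n = ℚP.toℚᵘ-injective (begin
  toℚᵘ (inv! n * ℕ→ℚ (n !))                         ≈⟨ ℚP.toℚᵘ-homo-* (inv! n) (ℕ→ℚ (n !)) ⟩
  toℚᵘ (inv! n) ℚᵘ.* toℚᵘ (ℕ→ℚ (n !))               ≈⟨ ℚᵘP.*-cong (toℚᵘ-/ 1 (n !) {{n !≢0}}) (toℚᵘ-/ (n !) 1) ⟩
  ((ℤ.+ 1 /ᵘ n !) {{n !≢0}}) ℚᵘ.* (ℤ.+ (n !) /ᵘ 1) ≈⟨ /d*d/1≃1 (n !) {{n !≢0}} ⟩
  ℚᵘ.1ℚᵘ                                            ∎)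
  where
  open ℚᵘP.≃-Reasoning
  /d*d/1≃1 : ∀ d .{{_ : ℕ.NonZero d}} → (ℤ.+ 1 /ᵘ d) ℚᵘ.* (ℤ.+ d /ᵘ 1) ℚᵘ.≃ ℚᵘ.1ℚᵘ
  /d*d/1≃1 (suc d) = *≡* (trans (ℤP.*-identityʳ _) (trans (ℤP.*-identityˡ _)
    (sym (trans (ℤP.*-identityˡ _) (cong ℤ.+_ (ℕP.*-identityʳ (suc d)))))))

ℕ→ℚ[1+n]*inv![1+n] : ∀ n → ℕ→ℚ (suc n) * inv! (suc n) ≡ inv! n
ℕ→ℚ[1+n]*inv![1+n] n = begin
  ℕ→ℚ (suc n) * inv! (suc n)                              ≡⟨ ℚP.*-identityʳ _ ⟨
  ℕ→ℚ (suc n) * inv! (suc n) * 1ℚ                         ≡⟨ cong (ℕ→ℚ (suc n) * inv! (suc n) *_) (inv!*ℕ→ℚ! n) ⟨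
  ℕ→ℚ (suc n) * inv! (suc n) * (inv! n * ℕ→ℚ (n !))
    ≡⟨ solve 4 (λ a b c d → a :* b :* (c :* d) := b :* (a :* d) :* c) refl (ℕ→ℚ (suc n)) (inv! (suc n)) (inv! n) (ℕ→ℚ (n !)) ⟩
  inv! (suc n) * (ℕ→ℚ (suc n) * ℕ→ℚ (n !)) * inv! n      ≡⟨ cong (λ x → inv! (suc n) * x * inv! n) (ℕ→ℚ-* (suc n) (n !)) ⟨
  inv! (suc n) * ℕ→ℚ (suc n !) * inv! n                   ≡⟨ cong (_* inv! n) (inv!*ℕ→ℚ! (suc n)) ⟩
  1ℚ * inv! n                                             ≡⟨ ℚP.*-identityˡ (inv! n) ⟩
  inv! n                                                  ∎
  where open ≡-Reasoning; open +-*-Solver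

sumTo-zero : ∀ g → sumTo 0 g ≡ g 0
sumTo-zero g = ℚP.+-identityʳ (g 0)

sumTo-suc : ∀ n g → sumTo (suc n) g ≡ g 0 + sumTo n (g ∘ suc)
sumTo-suc n g = cong (λ xs → g 0 + foldr _+_ 0ℚ xs)
  (trans (map-applyUpTo suc g (suc n)) (sym (map-applyUpTo id (g ∘ suc) (suc n))))

sumTo-sucʳ : ∀ n g → sumTo (suc n) g ≡ sumTo n g + g (suc n)
sumTo-sucʳ zero g = begin
  sumTo 1 g               ≡⟨ sumTo-suc 0 g ⟩
  g 0 + sumTo 0 (g ∘ suc) ≡⟨ cong (g 0 +_) (sumTo-zero (g ∘ suc)) ⟩
  g 0 + g 1               ≡⟨ cong (_+ g 1) (sumTo-zero g) ⟨
  sumTo 0 g + g 1         ∎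
  where open ≡-Reasoning
sumTo-sucʳ (suc n) g = begin
  sumTo (suc (suc n)) g                      ≡⟨ sumTo-suc (suc n) g ⟩
  g 0 + sumTo (suc n) (g ∘ suc)              ≡⟨ cong (g 0 +_) (sumTo-sucʳ n (g ∘ suc)) ⟩
  g 0 + (sumTo n (g ∘ suc) + g (suc (suc n))) ≡⟨ ℚP.+-assoc (g 0) _ _ ⟨
  g 0 + sumTo n (g ∘ suc) + g (suc (suc n))   ≡⟨ cong (_+ g (suc (suc n))) (sumTo-suc n g) ⟨
  sumTo (suc n) g + g (suc (suc n))          ∎
  where open ≡-Reasoning

sumTo-cong : ∀ n {g h} → (∀ t → g t ≡ h t) → sumTo n g ≡ sumTo n h
sumTo-cong n g≗h = cong (foldr _+_ 0ℚ) (map-cong g≗h (upTo (suc n)))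

sumTo-- : ∀ n g h → sumTo n (λ t → g t - h t) ≡ sumTo n g - sumTo n h
sumTo-- zero g h = begin
  sumTo 0 (λ t → g t - h t) ≡⟨ sumTo-zero (λ t → g t - h t) ⟩
  g 0 - h 0                 ≡⟨ cong₂ _-_ (sumTo-zero g) (sumTo-zero h) ⟨
  sumTo 0 g - sumTo 0 h     ∎
  where open ≡-Reasoning
sumTo-- (suc n) g h = begin
  sumTo (suc n) (λ t → g t - h t)                     ≡⟨ sumTo-suc n (λ t → g t - h t) ⟩
  (g 0 - h 0) + sumTo n (λ t → g (suc t) - h (suc t)) ≡⟨ cong ((g 0 - h 0) +_) (sumTo-- n (g ∘ suc) (h ∘ suc)) ⟩
  (g 0 - h 0) + (sumTo n (g ∘ suc) - sumTo n (h ∘ suc))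
    ≡⟨ solve 4 (λ a b x y → (a :- b) :+ (x :- y) := (a :+ x) :- (b :+ y)) refl (g 0) (h 0) _ _ ⟩
  (g 0 + sumTo n (g ∘ suc)) - (h 0 + sumTo n (h ∘ suc)) ≡⟨ cong₂ _-_ (sumTo-suc n g) (sumTo-suc n h) ⟨
  sumTo (suc n) g - sumTo (suc n) h                   ∎
  where open ≡-Reasoning; open +-*-Solver

altBinomTerm : ℕ → (ℕ → ℚ) → ℕ → ℚ
altBinomTerm e a t = sgn t * ℕ→ℚ (e C t) * a t

altBinomSum : ℕ → (ℕ → ℚ) → ℚ
altBinomSum e a = sumTo e (altBinomTerm e a)

altBinomSum-extend : ∀ e a → altBinomSum e a ≡ sumTo (suc e) (altBinomTerm e a)
altBinomSum-extend e a = sym (begin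
  sumTo (suc e) (altBinomTerm e a)                      ≡⟨ sumTo-sucʳ e (altBinomTerm e a) ⟩
  altBinomSum e a + altBinomTerm e a (suc e)            ≡⟨ cong (λ c → altBinomSum e a + sgn (suc e) * ℕ→ℚ c * a (suc e)) (k>n⇒nCk≡0 (ℕP.n<1+n e)) ⟩
  altBinomSum e a + sgn (suc e) * 0ℚ * a (suc e)
    ≡⟨ solve 3 (λ x s y → x :+ s :* con 0ℚ :* y := x) refl (altBinomSum e a) (sgn (suc e)) (a (suc e)) ⟩
  altBinomSum e a                                       ∎)
  where open ≡-Reasoning; open +-*-Solver

altBinomSum-suc : ∀ e a → altBinomSum (suc e) a ≡ altBinomSum e a - altBinomSum e (a ∘ suc)
altBinomSum-suc e a = begin
  altBinomSum (suc e) a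
    ≡⟨ sumTo-suc e (altBinomTerm (suc e) a) ⟩
  altBinomTerm e a 0 + sumTo e (λ t → altBinomTerm (suc e) a (suc t))
    ≡⟨ cong (altBinomTerm e a 0 +_) (sumTo-cong e pascal) ⟩
  altBinomTerm e a 0 + sumTo e (λ t → altBinomTerm e a (suc t) - altBinomTerm e (a ∘ suc) t)
    ≡⟨ cong (altBinomTerm e a 0 +_) (sumTo-- e (altBinomTerm e a ∘ suc) (altBinomTerm e (a ∘ suc))) ⟩
  altBinomTerm e a 0 + (sumTo e (altBinomTerm e a ∘ suc) - altBinomSum e (a ∘ suc))
    ≡⟨ ℚP.+-assoc (altBinomTerm e a 0) (sumTo e (altBinomTerm e a ∘ suc)) (- altBinomSum e (a ∘ suc)) ⟨
  altBinomTerm e a 0 + sumTo e (altBinomTerm e a ∘ suc) - altBinomSum e (a ∘ suc)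
    ≡⟨ cong (_- altBinomSum e (a ∘ suc)) (sumTo-suc e (altBinomTerm e a)) ⟨
  sumTo (suc e) (altBinomTerm e a) - altBinomSum e (a ∘ suc)
    ≡⟨ cong (_- altBinomSum e (a ∘ suc)) (altBinomSum-extend e a) ⟨
  altBinomSum e a - altBinomSum e (a ∘ suc)
    ∎
  where
  open ≡-Reasoning
  open +-*-Solver
  pascal : ∀ t → altBinomTerm (suc e) a (suc t) ≡ altBinomTerm e a (suc t) - altBinomTerm e (a ∘ suc) t
  pascal t = begin
    - sgn t * ℕ→ℚ (suc e C suc t) * a (suc t)
      ≡⟨ cong (λ c → - sgn t * ℕ→ℚ c * a (suc t)) (nCk+nC[k+1]≡[n+1]C[k+1] e t) ⟨
    - sgn t * ℕ→ℚ (e C t ℕ.+ e C suc t) * a (suc t)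
      ≡⟨ cong (λ c → - sgn t * c * a (suc t)) (ℕ→ℚ-+ (e C t) (e C suc t)) ⟩
    - sgn t * (ℕ→ℚ (e C t) + ℕ→ℚ (e C suc t)) * a (suc t)
      ≡⟨ solve 4 (λ s x y b → (:- s) :* (x :+ y) :* b := (:- s) :* y :* b :- s :* x :* b) refl (sgn t) _ _ (a (suc t)) ⟩
    - sgn t * ℕ→ℚ (e C suc t) * a (suc t) - sgn t * ℕ→ℚ (e C t) * a (suc t)
      ∎

D : ℕ → ℕ → ℚ
D e m = altBinomSum e (λ t → inv! (m ℕ.+ t))

D-zero : ∀ m → D 0 m ≡ inv! m
D-zero m = trans (sumTo-zero (altBinomTerm 0 (λ t → inv! (m ℕ.+ t))))
  (trans (ℚP.*-identityˡ (inv! (m ℕ.+ 0))) (cong inv! (ℕP.+-identityʳ m)))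

D-suc : ∀ e m → D (suc e) m ≡ D e m - D e (suc m)
D-suc e m = trans (altBinomSum-suc e (λ t → inv! (m ℕ.+ t)))
  (cong (_-_ (D e m)) (sumTo-cong e (λ t → cong (λ k → sgn t * ℕ→ℚ (e C t) * inv! k) (ℕP.+-suc m t))))

weightedGap : (ℕ → ℚ) → ℕ → ℚ
weightedGap x n = ℕ→ℚ (suc n) * x (suc n) - x n

weightedGap-Δ : ∀ {x y : ℕ → ℚ} → (∀ m → y m ≡ x m - x (suc m)) →
                ∀ n → weightedGap y n ≡ weightedGap x n - weightedGap x (suc n) + x (suc (suc n))
weightedGap-Δ {x} {y} y≡Δx n = begin
  ℕ→ℚ (suc n) * y (suc n) - y n
    ≡⟨ cong₂ (λ u v → ℕ→ℚ (suc n) * u - v) (y≡Δx (suc n)) (y≡Δx n) ⟩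
  ℕ→ℚ (suc n) * (x₁ - x₂) - (x₀ - x₁)
    ≡⟨ solve 4 (λ c x₀ x₁ x₂ → c :* (x₁ :- x₂) :- (x₀ :- x₁) := (c :* x₁ :- x₀) :- ((con 1ℚ :+ c) :* x₂ :- x₁) :+ x₂) refl (ℕ→ℚ (suc n)) x₀ x₁ x₂ ⟩
  (ℕ→ℚ (suc n) * x₁ - x₀) - ((1ℚ + ℕ→ℚ (suc n)) * x₂ - x₁) + x₂
    ≡⟨ cong (λ c → (ℕ→ℚ (suc n) * x₁ - x₀) - (c * x₂ - x₁) + x₂) (ℕ→ℚ-+ 1 (suc n)) ⟨
  weightedGap x n - weightedGap x (suc n) + x (suc (suc n))
    ∎
  where
  open ≡-Reasoning; open +-*-Solver
  x₀ = x n
  x₁ = x (suc n)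
  x₂ = x (suc (suc n))

D-gap-zero : ∀ n → weightedGap (D 0) n ≡ 0ℚ
D-gap-zero n = begin
  ℕ→ℚ (suc n) * D 0 (suc n) - D 0 n     ≡⟨ cong₂ (λ u v → ℕ→ℚ (suc n) * u - v) (D-zero (suc n)) (D-zero n) ⟩
  ℕ→ℚ (suc n) * inv! (suc n) - inv! n   ≡⟨ cong (_- inv! n) (ℕ→ℚ[1+n]*inv![1+n] n) ⟩
  inv! n - inv! n                       ≡⟨ ℚP.+-inverseʳ (inv! n) ⟩
  0ℚ                                    ∎
  where open ≡-Reasoning

D-gap-suc : ∀ e n → weightedGap (D (suc e)) n ≡ ℕ→ℚ (suc e) * D e (suc (suc n))
D-gap-suc zero n = begin
  weightedGap (D 1) n                                         ≡⟨ weightedGap-Δ {D 0} (D-suc 0) n ⟩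
  weightedGap (D 0) n - weightedGap (D 0) (suc n) + D 0 (2 ℕ.+ n) ≡⟨ cong₂ (λ u v → u - v + D 0 (2 ℕ.+ n)) (D-gap-zero n) (D-gap-zero (suc n)) ⟩
  0ℚ - 0ℚ + D 0 (2 ℕ.+ n)                                     ≡⟨ solve 1 (λ x → con 0ℚ :- con 0ℚ :+ x := con 1ℚ :* x) refl (D 0 (2 ℕ.+ n)) ⟩
  1ℚ * D 0 (2 ℕ.+ n)                                          ∎
  where open ≡-Reasoning; open +-*-Solver
D-gap-suc (suc e) n = begin
  weightedGap (D (2 ℕ.+ e)) n
    ≡⟨ weightedGap-Δ {D (suc e)} (D-suc (suc e)) n ⟩
  weightedGap (D (suc e)) n - weightedGap (D (suc e)) (suc n) + D (suc e) (2 ℕ.+ n)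
    ≡⟨ cong₂ (λ u v → u - v + D (suc e) (2 ℕ.+ n)) (D-gap-suc e n) (D-gap-suc e (suc n)) ⟩
  c * D e (2 ℕ.+ n) - c * D e (3 ℕ.+ n) + D (suc e) (2 ℕ.+ n)
    ≡⟨ solve 4 (λ c u v w → c :* u :- c :* v :+ w := c :* (u :- v) :+ w) refl c _ _ _ ⟩
  c * (D e (2 ℕ.+ n) - D e (3 ℕ.+ n)) + D (suc e) (2 ℕ.+ n)
    ≡⟨ cong (λ u → c * u + D (suc e) (2 ℕ.+ n)) (D-suc e (2 ℕ.+ n)) ⟨
  c * D (suc e) (2 ℕ.+ n) + D (suc e) (2 ℕ.+ n)
    ≡⟨ solve 2 (λ c w → c :* w :+ w := (con 1ℚ :+ c) :* w) refl c _ ⟩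
  (1ℚ + c) * D (suc e) (2 ℕ.+ n)
    ≡⟨ cong (_* D (suc e) (2 ℕ.+ n)) (ℕ→ℚ-+ 1 (suc e)) ⟨
  ℕ→ℚ (2 ℕ.+ e) * D (suc e) (2 ℕ.+ n)
    ∎
  where
  open ≡-Reasoning; open +-*-Solver
  c = ℕ→ℚ (suc e)

D-excess : ∀ e k → D (suc e) (suc k) - D e (2 ℕ.+ k) ≡ ℕ→ℚ k * D e (2 ℕ.+ k) - weightedGap (D e) (suc k)
D-excess e k = begin
  D (suc e) (suc k) - D e (2 ℕ.+ k)          ≡⟨ cong (_- D e (2 ℕ.+ k)) (D-suc e (suc k)) ⟩
  D e (suc k) - D e (2 ℕ.+ k) - D e (2 ℕ.+ k) ≡⟨ solve 3 (λ y x c → y :- x :- x := c :* x :- ((con (ℕ→ℚ 2) :+ c) :* x :- y)) refl (D e (suc k)) (D e (2 ℕ.+ k)) (ℕ→ℚ k) ⟩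
  ℕ→ℚ k * D e (2 ℕ.+ k) - ((ℕ→ℚ 2 + ℕ→ℚ k) * D e (2 ℕ.+ k) - D e (suc k))
    ≡⟨ cong (λ c → ℕ→ℚ k * D e (2 ℕ.+ k) - (c * D e (2 ℕ.+ k) - D e (suc k))) (ℕ→ℚ-+ 2 k) ⟨
  ℕ→ℚ k * D e (2 ℕ.+ k) - weightedGap (D e) (suc k) ∎
  where open ≡-Reasoning; open +-*-Solver

0≤ℕ→ℚ : ∀ n → 0ℚ ℚ.≤ ℕ→ℚ n
0≤ℕ→ℚ n = ℚP.nonNegative⁻¹ (ℕ→ℚ n) {{ℚP.normalize-nonNeg n 1}}

0≤inv! : ∀ n → 0ℚ ℚ.≤ inv! n
0≤inv! n = ℚP.nonNegative⁻¹ (inv! n) {{ℚP.normalize-nonNeg 1 (n !) {{n !≢0}}}}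

+-pres-0≤ : ∀ {x y} → 0ℚ ℚ.≤ x → 0ℚ ℚ.≤ y → 0ℚ ℚ.≤ x + y
+-pres-0≤ = ℚP.+-mono-≤

*-pres-0≤ : ∀ {x y} → 0ℚ ℚ.≤ x → 0ℚ ℚ.≤ y → 0ℚ ℚ.≤ x * y
*-pres-0≤ {x} {y} 0≤x 0≤y =
  ℚP.nonNegative⁻¹ (x * y) {{ℚP.nonNeg*nonNeg⇒nonNeg x {{nonNegative 0≤x}} y {{nonNegative 0≤y}}}}

D-excess-nonneg : ∀ {e m} → e < m → 0ℚ ℚ.≤ D (suc e) m - D e (suc m)
D-nonneg : ∀ {e m} → e ≤ m → 0ℚ ℚ.≤ D e m

D-excess-nonneg {zero} {suc k} _ =
  subst (0ℚ ℚ.≤_) (sym excess≡) (*-pres-0≤ (0≤ℕ→ℚ k) (0≤inv! (2 ℕ.+ k)))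
  where
  excess≡ : D 1 (suc k) - D 0 (2 ℕ.+ k) ≡ ℕ→ℚ k * inv! (2 ℕ.+ k)
  excess≡ = begin
    D 1 (suc k) - D 0 (2 ℕ.+ k)                                ≡⟨ D-excess 0 k ⟩
    ℕ→ℚ k * D 0 (2 ℕ.+ k) - weightedGap (D 0) (suc k)          ≡⟨ cong₂ (λ u v → ℕ→ℚ k * u - v) (D-zero (2 ℕ.+ k)) (D-gap-zero (suc k)) ⟩
    ℕ→ℚ k * inv! (2 ℕ.+ k) - 0ℚ                                ≡⟨ ℚP.+-identityʳ _ ⟩
    ℕ→ℚ k * inv! (2 ℕ.+ k)                                     ∎
    where open ≡-Reasoning
D-excess-nonneg {suc e} {suc k} (s≤s e<k) = subst (0ℚ ℚ.≤_) (sym excess≡)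
  (+-pres-0≤ (*-pres-0≤ (0≤ℕ→ℚ (suc e)) (D-excess-nonneg {e} {2 ℕ.+ k} (ℕP.m≤n⇒m≤1+n (ℕP.m≤n⇒m≤1+n e<k))))
             (*-pres-0≤ (0≤ℕ→ℚ d) (D-nonneg {suc e} {2 ℕ.+ k} (ℕP.m≤n⇒m≤1+n (ℕP.m≤n⇒m≤1+n e<k)))))
  where
  d = k ∸ suc e
  W = D (suc e) (2 ℕ.+ k)
  Z = D e (3 ℕ.+ k)
  excess≡ : D (2 ℕ.+ e) (suc k) - W ≡ ℕ→ℚ (suc e) * (W - Z) + ℕ→ℚ d * W
  excess≡ = begin
    D (2 ℕ.+ e) (suc k) - W                           ≡⟨ D-excess (suc e) k ⟩
    ℕ→ℚ k * W - weightedGap (D (suc e)) (suc k)       ≡⟨ cong₂ (λ c g → ℕ→ℚ c * W - g) (sym (ℕP.m+[n∸m]≡n e<k)) (D-gap-suc e (suc k)) ⟩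
    ℕ→ℚ (suc e ℕ.+ d) * W - ℕ→ℚ (suc e) * Z           ≡⟨ cong (λ c → c * W - ℕ→ℚ (suc e) * Z) (ℕ→ℚ-+ (suc e) d) ⟩
    (ℕ→ℚ (suc e) + ℕ→ℚ d) * W - ℕ→ℚ (suc e) * Z     ≡⟨ solve 4 (λ c δ w z → (c :+ δ) :* w :- c :* z := c :* (w :- z) :+ δ :* w) refl (ℕ→ℚ (suc e)) (ℕ→ℚ d) W Z ⟩
    ℕ→ℚ (suc e) * (W - Z) + ℕ→ℚ d * W               ∎
    where open ≡-Reasoning; open +-*-Solver

D-nonneg {zero} {m} _ = subst (0ℚ ℚ.≤_) (sym (D-zero m)) (0≤inv! m)
D-nonneg {suc e} {suc m} (s≤s e≤m) =
  subst (0ℚ ℚ.≤_) (solve 2 (λ w z → (w :- z) :+ z := w) refl (D (suc e) (suc m)) (D e (2 ℕ.+ m)))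
    (+-pres-0≤ (D-excess-nonneg (s≤s e≤m)) (D-nonneg (ℕP.m≤n⇒m≤1+n (ℕP.m≤n⇒m≤1+n e≤m))))
  where open +-*-Solver

D-gap-nonneg : ∀ {e n} → e ≤ 3 ℕ.+ n → 0ℚ ℚ.≤ weightedGap (D e) n
D-gap-nonneg {zero} {n} _ = subst (0ℚ ℚ.≤_) (sym (D-gap-zero n)) ℚP.≤-refl
D-gap-nonneg {suc e} {n} (s≤s e≤2+n) =
  subst (0ℚ ℚ.≤_) (sym (D-gap-suc e n)) (*-pres-0≤ (0≤ℕ→ℚ (suc e)) (D-nonneg e≤2+n))

D-weighted-nonneg : ∀ {e n k} → e ≤ n → suc n ≤ k → 0ℚ ℚ.≤ ℕ→ℚ k * D e (suc n) - D e n
D-weighted-nonneg {e} {n} {k} e≤n 1+n≤k = subst (0ℚ ℚ.≤_) (sym weighted≡)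
  (+-pres-0≤ (*-pres-0≤ (0≤ℕ→ℚ δ) (D-nonneg (ℕP.m≤n⇒m≤1+n e≤n))) (D-gap-nonneg (ℕP.≤-trans e≤n (ℕP.m≤n+m n 3))))
  where
  δ = k ∸ suc n
  weighted≡ : ℕ→ℚ k * D e (suc n) - D e n ≡ ℕ→ℚ δ * D e (suc n) + weightedGap (D e) n
  weighted≡ = begin
    ℕ→ℚ k * D e (suc n) - D e n                   ≡⟨ cong (λ c → ℕ→ℚ c * D e (suc n) - D e n) (ℕP.m+[n∸m]≡n 1+n≤k) ⟨
    ℕ→ℚ (suc n ℕ.+ δ) * D e (suc n) - D e n       ≡⟨ cong (λ c → c * D e (suc n) - D e n) (ℕ→ℚ-+ (suc n) δ) ⟩
    (ℕ→ℚ (suc n) + ℕ→ℚ δ) * D e (suc n) - D e n   ≡⟨ solve 4 (λ c δ x y → (c :+ δ) :* x :- y := δ :* x :+ (c :* x :- y)) refl (ℕ→ℚ (suc n)) (ℕ→ℚ δ) (D e (suc n)) (D e n) ⟩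
    ℕ→ℚ δ * D e (suc n) + weightedGap (D e) n    ∎
    where open ≡-Reasoning; open +-*-Solver

lemma5 : (f ℓ e p : ℕ) → e < f ∸ ℓ → p ℕ.+ e ≤ ℓ →
    0ℚ ℚ.≤ (ℕ→ℚ (f ∸ e) * sumTo e (λ t → sgn t * ℕ→ℚ (e C t) * inv! ((f ∸ ℓ) ℕ.+ p ℕ.+ t))
            - sumTo e (λ t → sgn t * ℕ→ℚ (e C t) * inv! ((f ∸ ℓ ∸ 1) ℕ.+ p ℕ.+ t)))
lemma5 f ℓ e p e<a p+e≤ℓ =
  subst (λ m → 0ℚ ℚ.≤ ℕ→ℚ (f ∸ e) * D e m - D e n) (sym a+p≡1+n) (D-weighted-nonneg e≤n 1+n≤f∸e)
  where
  a = f ∸ ℓ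
  n = a ∸ 1 ℕ.+ p
  a+p≡1+n : a ℕ.+ p ≡ suc n
  a+p≡1+n = cong (ℕ._+ p) (sym (ℕP.m+[n∸m]≡n (ℕP.≤-trans (s≤s z≤n) e<a)))
  e≤n : e ≤ n
  e≤n = ℕP.≤-trans (ℕP.∸-monoˡ-≤ 1 e<a) (ℕP.m≤m+n (a ∸ 1) p)
  ℓ≤f : ℓ ≤ f
  ℓ≤f = ℕP.<⇒≤ (ℕP.m∸n≢0⇒n<m (ℕP.m<n⇒n≢0 e<a))
  1+n≤f∸e : suc n ≤ f ∸ e
  1+n≤f∸e = subst (_≤ f ∸ e) a+p≡1+n (ℕP.m+n≤o⇒m≤o∸n (a ℕ.+ p) (begin
    a ℕ.+ p ℕ.+ e   ≡⟨ ℕP.+-assoc a p e ⟩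
    a ℕ.+ (p ℕ.+ e) ≤⟨ ℕP.+-monoʳ-≤ a p+e≤ℓ ⟩
    a ℕ.+ ℓ         ≡⟨ ℕP.m∸n+n≡m ℓ≤f ⟩
    f               ∎))
    where open ℕP.≤-Reasoning
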